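{- Consider \textsc{Rotor-Push} serving a request to element $e^*$ located at level $d^*$ of its tree, while $\textsc{Opt}$'s tree stays fixed. For $d\le d^*$ let $e_d=\mathrm{el}(P_d)$ be the element at the level-$d$ node of the global path before serving, and let $B=E\setminus(\{e^*\}\cup\{e_0,\dots,e_{d^*}\})$. Then the total change of credits caused by the service (push-down and flip) satisfies $\sum_{e\in B}\Delta c(e)\le f=4$.
   Context: Rotor-Push (Rtr) operates on a complete binary tree $T$ (root $r_T$ at level $0$) storing $n$ elements $E$, one per node; $\mathrm{el}(v)$ is the element at node $v$ and $\mathrm{nd}(e)$ the node of $e$. Each non-leaf node has a rotor pointer to a child. The global path $P$ is obtained by following pointers from the root; $P_d$ is its level-$d$ node; $\mathrm{flip}(d)$ toggles pointers at $P_{d'}$ for $d'<d$. Augmented push-down $\mathrm{PD}(u,v)$ for nodes $u,v$ on level $d$: with root-to-$v$ path $r_T=v_0,\dots,v_d=v$, cyclically move elements along $v_0\to v_1\to\dots\to v_d\to u\to v_0$. Upon a request to $e^*$ at level $d^*$, Rtr executes $\mathrm{PD}(\mathrm{nd}(e^*),P_{d^*})$ and then $\mathrm{flip}(d^*)$. The flip-rank $\mathrm{frnk}(w)$ of a level-$k$ node $w$ is the least number of consecutive $\mathrm{flip}(k)$ operations after which $w$ lies on $P$; $\mathrm{frnk}(e)$ is the flip-rank of $\mathrm{nd}(e)$. An offline algorithm $\textsc{Opt}$ keeps the same elements on a tree of the same shape; $\ell(e)$ and $\ell^{\mathrm{opt}}(e)$ are the levels of $e$ in Rtr's and $\textsc{Opt}$'s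 trees. Level-weight: $w^{\mathrm{LEV}}(e)=\ell(e)-2\ell^{\mathrm{opt}}(e)-1$ if $\ell(e)\ge 2\ell^{\mathrm{opt}}(e)+2$, else $0$. Flip-rank-weight: $w^{\mathrm{FRNK}}(e)=1-\mathrm{frnk}(e)/2^{\ell(e)}$ if $\ell(e)\ge 2\ell^{\mathrm{opt}}(e)+1$, else $0$. Credit $c(e)=f\cdot(w^{\mathrm{LEV}}(e)+w^{\mathrm{FRNK}}(e))$ with $f=4$; $\Delta c(e)$ is its change from before to after serving the request. -}

module Defs where

open import Data.Bool using (Bool; true; false; not; if_then_else_; _∧_)
open import Data.Bool.Properties using () renaming (_≟_ to _≟B_)
open import Data.Nat as ℕ using (ℕ; zero; suc; _∸_; _^_; _<ᵇ_; _≤ᵇ_)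
open import Data.Nat.Properties using (m^n≢0)
open import Data.Fin using (Fin; zero; suc) renaming (_≟_ to _≟F_)
open import Data.Product using (∃)
open import Data.List using (List; []; _∷_; _++_; [_]; length)
open import Data.List.Properties using (≡-dec)
open import Data.Integer using (+_)
open import Data.Rational using (ℚ; 0ℚ; 1ℚ; _+_; _-_; _*_; _/_)
open import Relation.Nullary.Decidable using (⌊_⌋; Dec; yes; no)
open import Relation.Binary.PropositionalEquality using (_≡_)

-- Nodes of the (perfect) binary tree of height H (levels 0..H) are
-- identified with their root-to-node direction strings
-- (false = left child, true = right child), listed root-first.

Path : Set
Path = List Bool

_≟P_ : (p q : Path) → Dec (p ≡ q)
_≟P_ = ≡-dec _≟B_

level : Path → ℕ
level = length

size : ℕ → ℕ
size H = 2 ^ suc H ∸ 1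

-- Rotor configuration: the pointer stored at every (internal) node,
-- false = points to the left child, true = to the right child.
-- (Values at leaves or outside the tree are never consulted.)
Rotors : Set
Rotors = Path → Bool

gpath : Rotors → ℕ → Path
gpath ρ zero    = []
gpath ρ (suc d) = gpath ρ d ++ [ ρ (gpath ρ d) ]

onPath : Rotors → Path → Bool
onPath ρ q = ⌊ q ≟P gpath ρ (level q) ⌋

flip : ℕ → Rotors → Rotors
flip d ρ q = if (level q <ᵇ d) ∧ onPath ρ q then not (ρ q) else ρ q

flips : ℕ → ℕ → Rotors → Rotors
flips k zero    ρ = ρ
flips k (suc m) ρ = flips k m (flip k ρ)

-- Least m ≥ start (searching `fuel` candidates) such that after m
-- consecutive flip(k) operations node w (at level k) lies on P.
-- Falls back to start + fuel if none is found in the window.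
searchFrnk : Rotors → Path → (start fuel : ℕ) → ℕ
searchFrnk ρ w start zero = start
searchFrnk ρ w start (suc fuel) =
  if ⌊ w ≟P gpath (flips (level w) start ρ) (level w) ⌋
  then start
  else searchFrnk ρ w (suc start) fuel

-- flip-rank of a node w at level k: the least number of consecutive
-- flip(k) operations after which w lies on P.  (Such a number always
-- exists and is < 2^k, so searching 0 .. 2^k - 1 finds the least one.)
frnk : Rotors → Path → ℕ
frnk ρ w = searchFrnk ρ w 0 (2 ^ level w)

record Placement (H : ℕ) : Set where
  field
    nd        : Fin (size H) → Path
    inTree    : ∀ e → level (nd e) ℕ.≤ H
    injective : ∀ e e′ → nd e ≡ nd e′ → e ≡ e′
    onto      : ∀ p → level p ℕ.≤ H → ∃ λ e → nd e ≡ p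

f : ℚ
f = + 4 / 1

ℕ→ℚ : ℕ → ℚ
ℕ→ℚ n = + n / 1

-- w^LEV(e) for ℓ = ℓ(e), o = ℓ^opt(e)
wLEV : (ℓ o : ℕ) → ℚ
wLEV ℓ o = if 2 ℕ.* o ℕ.+ 2 ≤ᵇ ℓ then ℕ→ℚ (ℓ ∸ (2 ℕ.* o) ∸ 1) else 0ℚ

-- w^FRNK(e) for ℓ = ℓ(e), o = ℓ^opt(e), r = frnk(e)
wFRNK : (ℓ o r : ℕ) → ℚ
wFRNK ℓ o r = if 2 ℕ.* o ℕ.+ 1 ≤ᵇ ℓ then 1ℚ - _/_ (+ r) (2 ^ ℓ) {{m^n≢0 2 ℓ}} else 0ℚ

credit : Rotors → Path → ℕ → ℚ
credit ρ p o = f * (wLEV (level p) o + wFRNK (level p) o (frnk ρ p))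

-- Serving a request to e* (at level d* = level (nd e*)):
-- PD(nd(e*), P_{d*}) then flip(d*).

module _ (H : ℕ) (nd : Fin (size H) → Path) (ρ : Rotors) (e* : Fin (size H)) where

  d* : ℕ
  d* = level (nd e*)

  -- node of each element after PD(nd e*, P_{d*}):
  -- the element at u = nd e* moves to v_0 = root, the element at v_i moves
  -- to v_{i+1} (i < d*), and the element at v_{d*} moves to u.
  ndAfter : Fin (size H) → Path
  ndAfter e with ⌊ e ≟F e* ⌋
  ... | true = []
  ... | false =
    if onPath ρ (nd e) ∧ (level (nd e) <ᵇ d*) then gpath ρ (suc (level (nd e)))
    else if onPath ρ (nd e) ∧ (level (nd e) ℕ.≡ᵇ d*) then nd e*
    else nd e

  rotorsAfter : Rotors
  rotorsAfter = flip d* ρ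

  inB : Fin (size H) → Bool
  inB e = not ⌊ e ≟F e* ⌋ ∧ not (onPath ρ (nd e) ∧ (level (nd e) ≤ᵇ d*))

sumFin : (n : ℕ) → (Fin n → ℚ) → ℚ
sumFin zero    g = 0ℚ
sumFin (suc n) g = g zero + sumFin n (λ i → g (suc i))

sumΔcB : (H : ℕ) (nd ndOpt : Fin (size H) → Path) (ρ : Rotors) (e* : Fin (size H)) → ℚ
sumΔcB H nd ndOpt ρ e* = sumFin (size H) λ e →
  if inB H nd ρ e* e
  then credit (rotorsAfter H nd ρ e*) (ndAfter H nd ρ e* e) (level (ndOpt e))
       - credit ρ (nd e) (level (ndOpt e))
  else 0ℚ

module Submission where

-- For e ∈ B the push-down leaves e at its node and Opt's tree is fixed, so only the
-- flip-rank term of c(e) can change.  The flip-rank of a node can be read in binary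
-- off the rotors along its root path, the root rotor (toggled by every flip) giving
-- the least significant digit; hence a flip lowers any flip-rank by at most one, and
-- Δc(e) ≤ f/2^ℓ(e) ≤ f/2^(2ℓᵒᵖᵗ(e)+1).  Since Opt has at most 2^k elements on level k,
-- the sum over B is at most f · Σₖ 2^k/2^(2k+1) ≤ f.

open import Defs

open import Algebra.Properties.CommutativeSemigroup using (x∙yz≈y∙xz)
open import Data.Bool using (Bool; true; false; not; T; if_then_else_)
open import Data.Bool.Properties using (∧-zeroʳ) renaming (_≟_ to _≟B_)
open import Data.Empty using (⊥-elim)
open import Data.Fin using (Fin; zero; suc) renaming (_≟_ to _≟F_)
open import Data.Fin.Properties using (0≢1+n; suc-injective)
open import Data.Integer using (+_)
import Data.Integer as ℤ
import Data.Integer.Properties as ℤ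
open import Data.Integer.Solver renaming (module +-*-Solver to ℤ-Solver)
open import Data.List using (List; []; _∷_; _++_; [_]; map; tabulate)
open import Data.List.Properties using (∷-injective; map-++; map-∘)
open import Data.List.Membership.Propositional using (_∈_)
open import Data.List.Membership.Propositional.Properties using (∈-++⁺ˡ; ∈-++⁺ʳ; ∈-map⁺)
open import Data.List.Relation.Unary.Any using (here; there; _─_)
open import Data.Nat as ℕ using (ℕ; zero; suc; _∸_; _^_; _<ᵇ_; _≤ᵇ_; _≡ᵇ_; z≤n; s≤s; NonZero)
import Data.Nat.Properties as ℕ
open import Data.Nat.ListAction using (sum)
open import Data.Nat.ListAction.Properties using (sum-++)
open import Data.Nat.Tactic.RingSolver using (solve-∀)
open import Data.Product using (_×_; _,_; proj₁; proj₂)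
open import Data.Rational using (ℚ; 0ℚ; 1ℚ; _+_; _-_; _*_; _/_; _≤_; -_; toℚᵘ)
open import Data.Rational.Properties
open import Data.Rational.Solver using (module +-*-Solver)
import Data.Rational.Unnormalised as ℚᵘ
import Data.Rational.Unnormalised.Properties as ℚᵘ
open import Data.Unit using (tt)
open import Function.Base using (_∘_)
open import Function.Definitions using (Injective)
open import Relation.Binary.PropositionalEquality
  using (_≡_; _≢_; _≗_; refl; sym; trans; cong; cong₂; subst; subst₂; module ≡-Reasoning)
open import Relation.Nullary using (¬_; Dec; yes; no; contradiction)
open import Relation.Nullary.Decidable using (⌊_⌋)

subtree : Bool → Rotors → Rotors
subtree b ρ q = ρ (b ∷ q)

gpath-cong : ∀ {ρ σ} → ρ ≗ σ → ∀ d → gpath ρ d ≡ gpath σ d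
gpath-cong ρ≗σ zero = refl
gpath-cong {σ = σ} ρ≗σ (suc d) rewrite gpath-cong ρ≗σ d = cong (λ b → gpath σ d ++ [ b ]) (ρ≗σ _)

flip-cong : ∀ {ρ σ} k → ρ ≗ σ → flip k ρ ≗ flip k σ
flip-cong k ρ≗σ q rewrite ρ≗σ q | gpath-cong ρ≗σ (level q) = refl

flips-cong : ∀ {ρ σ} k m → ρ ≗ σ → flips k m ρ ≗ flips k m σ
flips-cong k zero ρ≗σ = ρ≗σ
flips-cong k (suc m) ρ≗σ = flips-cong k m (flip-cong k ρ≗σ)

gpath-subtree : ∀ ρ d → gpath ρ (suc d) ≡ ρ [] ∷ gpath (subtree (ρ []) ρ) d
gpath-subtree ρ zero = refl
gpath-subtree ρ (suc d) rewrite gpath-subtree ρ d = refl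

onPath-∷-toward : ∀ ρ b q → b ≡ ρ [] → onPath ρ (b ∷ q) ≡ onPath (subtree b ρ) q
onPath-∷-toward ρ _ q refl
  with (ρ [] ∷ q) ≟P gpath ρ (suc (level q)) | q ≟P gpath (subtree (ρ []) ρ) (level q)
... | yes _ | yes _ = refl
... | no _  | no _  = refl
... | yes on | no off = ⊥-elim (off (proj₂ (∷-injective (trans on (gpath-subtree ρ (level q))))))
... | no off | yes on = ⊥-elim (off (trans (cong (ρ [] ∷_) on) (sym (gpath-subtree ρ (level q)))))

onPath-∷-away : ∀ ρ b q → b ≢ ρ [] → onPath ρ (b ∷ q) ≡ false
onPath-∷-away ρ b q b≢ρ[] with (b ∷ q) ≟P gpath ρ (suc (level q))
... | yes on = ⊥-elim (b≢ρ[] (proj₁ (∷-injective (trans on (gpath-subtree ρ (level q))))))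
... | no _ = refl

subtree-flip-toward : ∀ k ρ b → b ≡ ρ [] → subtree b (flip (suc k) ρ) ≗ flip k (subtree b ρ)
subtree-flip-toward k ρ b b≡ρ[] q rewrite onPath-∷-toward ρ b q b≡ρ[] = refl

subtree-flip-away : ∀ k ρ b → b ≢ ρ [] → subtree b (flip (suc k) ρ) ≗ subtree b ρ
subtree-flip-away k ρ b b≢ρ[] q rewrite onPath-∷-away ρ b q b≢ρ[] | ∧-zeroʳ (level q <ᵇ k) = refl

rootPointsTo : Rotors → Bool → Bool
rootPointsTo ρ b = ⌊ ρ [] ≟B b ⌋

rootPointsTo-flip : ∀ k ρ b → rootPointsTo (flip (suc k) ρ) b ≡ not (rootPointsTo ρ b)
rootPointsTo-flip k ρ b = not-≟ (ρ []) b
  where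
  not-≟ : ∀ x b → ⌊ not x ≟B b ⌋ ≡ not ⌊ x ≟B b ⌋
  not-≟ false false = refl
  not-≟ false true  = refl
  not-≟ true  false = refl
  not-≟ true  true  = refl

toggle : ℕ → Bool → Bool
toggle zero    s = s
toggle (suc t) s = toggle t (not s)

-- the number of i < t with toggle i s ≡ true
countTrue : ℕ → Bool → ℕ
countTrue zero    s     = zero
countTrue (suc t) true  = suc (countTrue t false)
countTrue (suc t) false = countTrue t true

rootPointsTo-flips : ∀ k b t ρ → rootPointsTo (flips (suc k) t ρ) b ≡ toggle t (rootPointsTo ρ b)
rootPointsTo-flips k b zero ρ = refl
rootPointsTo-flips k b (suc t) ρ =
  trans (rootPointsTo-flips k b t (flip (suc k) ρ)) (cong (toggle t) (rootPointsTo-flip k ρ b))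

-- Of t flips, only those during which the root points to b reach the subtree at b.
subtree-flips : ∀ k b t ρ → subtree b (flips (suc k) t ρ) ≗ flips k (countTrue t (rootPointsTo ρ b)) (subtree b ρ)
subtree-flips k b zero ρ q = refl
subtree-flips k b (suc t) ρ q = begin
  subtree b (flips (suc k) t (flip (suc k) ρ)) q
    ≡⟨ subtree-flips k b t (flip (suc k) ρ) q ⟩
  flips k (countTrue t (rootPointsTo (flip (suc k) ρ) b)) (subtree b (flip (suc k) ρ)) q
    ≡⟨ cong (λ s → flips k (countTrue t s) (subtree b (flip (suc k) ρ)) q) (rootPointsTo-flip k ρ b) ⟩
  flips k (countTrue t (not ⌊ ρ≟b ⌋)) (subtree b (flip (suc k) ρ)) q
    ≡⟨ step ρ≟b ⟩
  flips k (countTrue (suc t) ⌊ ρ≟b ⌋) (subtree b ρ) q ∎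
  where
  open ≡-Reasoning
  ρ≟b : Dec (ρ [] ≡ b)
  ρ≟b = ρ [] ≟B b
  step : (d : Dec (ρ [] ≡ b)) →
    flips k (countTrue t (not ⌊ d ⌋)) (subtree b (flip (suc k) ρ)) q ≡ flips k (countTrue (suc t) ⌊ d ⌋) (subtree b ρ) q
  step (yes ρ[]≡b) = flips-cong k (countTrue t false) (subtree-flip-toward k ρ b (sym ρ[]≡b)) q
  step (no ρ[]≢b)  = flips-cong k (countTrue t true) (subtree-flip-away k ρ b (λ b≡ρ[] → ρ[]≢b (sym b≡ρ[]))) q

rootPointsTo⁺ : ∀ ρ b → ρ [] ≡ b → rootPointsTo ρ b ≡ true
rootPointsTo⁺ ρ b ρ[]≡b with ρ [] ≟B b
... | yes _ = refl
... | no ρ[]≢b = ⊥-elim (ρ[]≢b ρ[]≡b)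

rootPointsTo⁻ : ∀ ρ b → rootPointsTo ρ b ≡ true → ρ [] ≡ b
rootPointsTo⁻ ρ b _ with ρ [] ≟B b
rootPointsTo⁻ ρ b _  | yes ρ[]≡b = ρ[]≡b
rootPointsTo⁻ ρ b () | no _

OnPathAfter : Rotors → Path → ℕ → Set
OnPathAfter ρ w t = w ≡ gpath (flips (level w) t ρ) (level w)

onPathAfter-∷⁻ : ∀ ρ b w t → OnPathAfter ρ (b ∷ w) t →
  toggle t (rootPointsTo ρ b) ≡ true × OnPathAfter (subtree b ρ) w (countTrue t (rootPointsTo ρ b))
onPathAfter-∷⁻ ρ b w t on = root , rest
  where
  k : ℕ
  k = level w
  ρₜ : Rotors
  ρₜ = flips (suc k) t ρ
  b≡ρₜ[] : b ≡ ρₜ []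
  b≡ρₜ[] = proj₁ (∷-injective (trans on (gpath-subtree ρₜ k)))
  root : toggle t (rootPointsTo ρ b) ≡ true
  root = trans (sym (rootPointsTo-flips k b t ρ)) (rootPointsTo⁺ ρₜ b (sym b≡ρₜ[]))
  rest : OnPathAfter (subtree b ρ) w (countTrue t (rootPointsTo ρ b))
  rest = begin
    w                             ≡⟨ proj₂ (∷-injective (trans on (gpath-subtree ρₜ k))) ⟩
    gpath (subtree (ρₜ []) ρₜ) k  ≡⟨ cong (λ c → gpath (subtree c ρₜ) k) (sym b≡ρₜ[]) ⟩
    gpath (subtree b ρₜ) k        ≡⟨ gpath-cong (subtree-flips k b t ρ) k ⟩
    gpath (flips k (countTrue t (rootPointsTo ρ b)) (subtree b ρ)) k ∎
    where open ≡-Reasoning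

onPathAfter-∷⁺ : ∀ ρ b w t → toggle t (rootPointsTo ρ b) ≡ true →
  OnPathAfter (subtree b ρ) w (countTrue t (rootPointsTo ρ b)) → OnPathAfter ρ (b ∷ w) t
onPathAfter-∷⁺ ρ b w t root on = begin
  b ∷ w                                ≡⟨ cong₂ _∷_ (sym ρₜ[]≡b) w≡ ⟩
  ρₜ [] ∷ gpath (subtree (ρₜ []) ρₜ) k  ≡⟨ sym (gpath-subtree ρₜ k) ⟩
  gpath ρₜ (suc k)                     ∎
  where
  open ≡-Reasoning
  k : ℕ
  k = level w
  ρₜ : Rotors
  ρₜ = flips (suc k) t ρ
  ρₜ[]≡b : ρₜ [] ≡ b
  ρₜ[]≡b = rootPointsTo⁻ ρₜ b (trans (rootPointsTo-flips k b t ρ) root)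
  w≡ : w ≡ gpath (subtree (ρₜ []) ρₜ) k
  w≡ = trans on (trans (sym (gpath-cong (subtree-flips k b t ρ) k)) (cong (λ c → gpath (subtree c ρₜ) k) (sym ρₜ[]≡b)))

double : ℕ → ℕ
double zero    = zero
double (suc x) = suc (suc (double x))

double≡2* : ∀ x → double x ≡ 2 ℕ.* x
double≡2* zero    = refl
double≡2* (suc x) = trans (cong (λ y → suc (suc y)) (double≡2* x)) (sym (ℕ.*-suc 2 x))

double-mono-≤ : ∀ {x y} → x ℕ.≤ y → double x ℕ.≤ double y
double-mono-≤ {zero}  _         = z≤n
double-mono-≤ {suc x} (s≤s x≤y) = s≤s (s≤s (double-mono-≤ x≤y))

shiftIn : Bool → ℕ → ℕ
shiftIn true  x = double x
shiftIn false x = suc (double x)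

shiftIn-mono-≤ : ∀ s {x y} → x ℕ.≤ y → shiftIn s x ℕ.≤ shiftIn s y
shiftIn-mono-≤ true  x≤y = double-mono-≤ x≤y
shiftIn-mono-≤ false x≤y = s≤s (double-mono-≤ x≤y)

shiftIn-≤ : ∀ s x → shiftIn s x ℕ.≤ suc (double x)
shiftIn-≤ true  x = ℕ.n≤1+n (double x)
shiftIn-≤ false x = ℕ.≤-refl

toggle-double : ∀ x → toggle (double x) true ≡ true
toggle-double zero    = refl
toggle-double (suc x) = toggle-double x

toggle-shiftIn : ∀ s x → toggle (shiftIn s x) s ≡ true
toggle-shiftIn true  x = toggle-double x
toggle-shiftIn false x = toggle-double x

countTrue-double : ∀ x → countTrue (double x) true ≡ x
countTrue-double zero    = refl
countTrue-double (suc x) = cong suc (countTrue-double x)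

countTrue-shiftIn : ∀ s x → countTrue (shiftIn s x) s ≡ x
countTrue-shiftIn true  x = countTrue-double x
countTrue-shiftIn false x = countTrue-double x

shiftIn-countTrue-≤ : ∀ s t → toggle t s ≡ true → shiftIn s (countTrue t s) ℕ.≤ t
shiftIn-countTrue-≤ true  zero    _    = z≤n
shiftIn-countTrue-≤ true  (suc t) root = s≤s (shiftIn-countTrue-≤ false t root)
shiftIn-countTrue-≤ false zero    ()
shiftIn-countTrue-≤ false (suc t) root = s≤s (shiftIn-countTrue-≤ true t root)

-- The flip-rank read in binary off the rotors along w, least significant digit first.
rank : Rotors → Path → ℕ
rank ρ []      = 0
rank ρ (b ∷ w) = shiftIn (rootPointsTo ρ b) (rank (subtree b ρ) w)

rank-cong : ∀ {ρ σ} → ρ ≗ σ → ∀ w → rank ρ w ≡ rank σ w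
rank-cong ρ≗σ []      = refl
rank-cong ρ≗σ (b ∷ w) =
  cong₂ shiftIn (cong (λ r → ⌊ r ≟B b ⌋) (ρ≗σ [])) (rank-cong (λ q → ρ≗σ (b ∷ q)) w)

onPathAfter-rank : ∀ ρ w → OnPathAfter ρ w (rank ρ w)
onPathAfter-rank ρ []      = refl
onPathAfter-rank ρ (b ∷ w) = onPathAfter-∷⁺ ρ b w (rank ρ (b ∷ w)) (toggle-shiftIn (rootPointsTo ρ b) x)
  (subst (OnPathAfter (subtree b ρ) w) (sym (countTrue-shiftIn (rootPointsTo ρ b) x)) (onPathAfter-rank (subtree b ρ) w))
  where
  x : ℕ
  x = rank (subtree b ρ) w

rank-minimal : ∀ ρ w t → OnPathAfter ρ w t → rank ρ w ℕ.≤ t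
rank-minimal ρ []      t _  = z≤n
rank-minimal ρ (b ∷ w) t on = ℕ.≤-trans
  (shiftIn-mono-≤ (rootPointsTo ρ b) (rank-minimal (subtree b ρ) w _ (proj₂ on⁻)))
  (shiftIn-countTrue-≤ (rootPointsTo ρ b) t (proj₁ on⁻))
  where
  on⁻ : toggle t (rootPointsTo ρ b) ≡ true × OnPathAfter (subtree b ρ) w (countTrue t (rootPointsTo ρ b))
  on⁻ = onPathAfter-∷⁻ ρ b w t on

rank<2^level : ∀ ρ w → rank ρ w ℕ.< 2 ^ level w
rank<2^level ρ []      = s≤s z≤n
rank<2^level ρ (b ∷ w) = begin
  suc (shiftIn (rootPointsTo ρ b) x) ≤⟨ s≤s (shiftIn-≤ (rootPointsTo ρ b) x) ⟩
  double (suc x)                     ≤⟨ double-mono-≤ (rank<2^level (subtree b ρ) w) ⟩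
  double (2 ^ level w)               ≡⟨ double≡2* (2 ^ level w) ⟩
  2 ^ level (b ∷ w)                  ∎
  where
  open ℕ.≤-Reasoning
  x : ℕ
  x = rank (subtree b ρ) w

rank-flip : ∀ d ρ w → rank ρ w ℕ.≤ suc (rank (flip d ρ) w)
rank-flip d       ρ []      = z≤n
rank-flip zero    ρ (b ∷ w) = ℕ.≤-trans (ℕ.n≤1+n _) (s≤s (ℕ.≤-reflexive (rank-cong {ρ} {flip zero ρ} (λ _ → refl) (b ∷ w))))
rank-flip (suc d) ρ (b ∷ w) =
  subst (λ s → rank ρ (b ∷ w) ℕ.≤ suc (shiftIn s (rank (subtree b (flip (suc d) ρ)) w)))
    (sym (rootPointsTo-flip d ρ b)) (by-root (ρ [] ≟B b))
  where
  by-root : (ρ[]≟b : Dec (ρ [] ≡ b)) →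
    shiftIn ⌊ ρ[]≟b ⌋ (rank (subtree b ρ) w) ℕ.≤ suc (shiftIn (not ⌊ ρ[]≟b ⌋) (rank (subtree b (flip (suc d) ρ)) w))
  by-root (yes ρ[]≡b) rewrite rank-cong (subtree-flip-toward d ρ b (sym ρ[]≡b)) w =
    double-mono-≤ (rank-flip d (subtree b ρ) w)
  by-root (no ρ[]≢b) rewrite rank-cong (subtree-flip-away d ρ b (λ b≡ρ[] → ρ[]≢b (sym b≡ρ[]))) w =
    ℕ.≤-refl

searchFrnk≡rank : ∀ ρ w fuel start → start ℕ.≤ rank ρ w → rank ρ w ℕ.< start ℕ.+ fuel →
  searchFrnk ρ w start fuel ≡ rank ρ w
searchFrnk≡rank ρ w zero start start≤r r<end =
  ⊥-elim (ℕ.<-irrefl refl (ℕ.≤-trans r<end (subst (ℕ._≤ rank ρ w) (sym (ℕ.+-identityʳ start)) start≤r)))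
searchFrnk≡rank ρ w (suc fuel) start start≤r r<end with w ≟P gpath (flips (level w) start ρ) (level w)
... | yes on  = ℕ.≤-antisym start≤r (rank-minimal ρ w start on)
... | no off = searchFrnk≡rank ρ w fuel (suc start)
  (ℕ.≤∧≢⇒< start≤r (λ start≡r → off (subst (OnPathAfter ρ w) (sym start≡r) (onPathAfter-rank ρ w))))
  (subst (rank ρ w ℕ.<_) (ℕ.+-suc start fuel) r<end)

frnk≡rank : ∀ ρ w → frnk ρ w ≡ rank ρ w
frnk≡rank ρ w = searchFrnk≡rank ρ w (2 ^ level w) 0 z≤n (rank<2^level ρ w)

frnk-flip : ∀ d ρ w → frnk ρ w ℕ.≤ suc (frnk (flip d ρ) w)
frnk-flip d ρ w rewrite frnk≡rank ρ w | frnk≡rank (flip d ρ) w = rank-flip d ρ w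

sum-map-─ : ∀ {A : Set} (w : A → ℕ) {x xs} (x∈xs : x ∈ xs) → sum (map w xs) ≡ w x ℕ.+ sum (map w (xs ─ x∈xs))
sum-map-─ w (here refl) = refl
sum-map-─ w {x} {y ∷ xs} (there x∈xs) = begin
  w y ℕ.+ sum (map w xs)                     ≡⟨ cong (w y ℕ.+_) (sum-map-─ w x∈xs) ⟩
  w y ℕ.+ (w x ℕ.+ sum (map w (xs ─ x∈xs)))  ≡⟨ x∙yz≈y∙xz ℕ.+-commutativeSemigroup (w y) (w x) _ ⟩
  w x ℕ.+ (w y ℕ.+ sum (map w (xs ─ x∈xs)))  ∎
  where open ≡-Reasoning

∈-─ : ∀ {A : Set} {x y : A} {xs} (x∈xs : x ∈ xs) → y ∈ xs → y ≢ x → y ∈ (xs ─ x∈xs)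
∈-─ (here refl)  (here refl)  y≢x = ⊥-elim (y≢x refl)
∈-─ (here refl)  (there y∈xs) _   = y∈xs
∈-─ (there x∈xs) (here refl)  _   = here refl
∈-─ (there x∈xs) (there y∈xs) y≢x = there (∈-─ x∈xs y∈xs y≢x)

sum-tabulate-injective-≤ : ∀ {A : Set} {n} (w : A → ℕ) (g : Fin n → A) → Injective _≡_ _≡_ g →
  (xs : List A) → (∀ i → g i ∈ xs) → sum (tabulate (w ∘ g)) ℕ.≤ sum (map w xs)
sum-tabulate-injective-≤ {n = zero}  w g g-inj xs g∈xs = z≤n
sum-tabulate-injective-≤ {n = suc n} w g g-inj xs g∈xs = begin
  w (g zero) ℕ.+ sum (tabulate (w ∘ g ∘ suc))   ≤⟨ ℕ.+-monoʳ-≤ (w (g zero)) rest ⟩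
  w (g zero) ℕ.+ sum (map w (xs ─ g∈xs zero))   ≡⟨ sym (sum-map-─ w (g∈xs zero)) ⟩
  sum (map w xs)                                 ∎
  where
  open ℕ.≤-Reasoning
  rest : sum (tabulate (w ∘ g ∘ suc)) ℕ.≤ sum (map w (xs ─ g∈xs zero))
  rest = sum-tabulate-injective-≤ w (g ∘ suc) (λ eq → suc-injective (g-inj eq)) (xs ─ g∈xs zero)
    (λ i → ∈-─ (g∈xs zero) (g∈xs (suc i)) (λ eq → 0≢1+n (sym (g-inj eq))))

weight : ℕ → Path → ℕ
weight H p = 4 ^ (H ∸ level p)

nodes : ℕ → List Path
nodes zero    = [ [] ]
nodes (suc H) = [] ∷ map (false ∷_) (nodes H) ++ map (true ∷_) (nodes H)

∈-nodes : ∀ H p → level p ℕ.≤ H → p ∈ nodes H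
∈-nodes zero    []          _         = here refl
∈-nodes (suc H) []          _         = here refl
∈-nodes (suc H) (false ∷ p) (s≤s p≤H) = there (∈-++⁺ˡ (∈-map⁺ (false ∷_) (∈-nodes H p p≤H)))
∈-nodes (suc H) (true ∷ p)  (s≤s p≤H) =
  there (∈-++⁺ʳ (map (false ∷_) (nodes H)) (∈-map⁺ (true ∷_) (∈-nodes H p p≤H)))

sum-weight-nodes : ∀ H → sum (map (weight H) (nodes H)) ℕ.≤ 2 ℕ.* 4 ^ H
sum-weight-nodes zero    = s≤s z≤n
sum-weight-nodes (suc H) = begin
  4 ^ suc H ℕ.+ sum (map (weight (suc H)) (map (false ∷_) (nodes H) ++ map (true ∷_) (nodes H)))
    ≡⟨ cong (4 ^ suc H ℕ.+_) children ⟩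
  4 ^ suc H ℕ.+ (S ℕ.+ S)
    ≤⟨ ℕ.+-monoʳ-≤ (4 ^ suc H) (ℕ.+-mono-≤ (sum-weight-nodes H) (sum-weight-nodes H)) ⟩
  4 ℕ.* 4 ^ H ℕ.+ (2 ℕ.* 4 ^ H ℕ.+ 2 ℕ.* 4 ^ H)
    ≡⟨ arith (4 ^ H) ⟩
  2 ℕ.* 4 ^ suc H ∎
  where
  open ℕ.≤-Reasoning
  S : ℕ
  S = sum (map (weight H) (nodes H))
  arith : ∀ x → 4 ℕ.* x ℕ.+ (2 ℕ.* x ℕ.+ 2 ℕ.* x) ≡ 2 ℕ.* (4 ℕ.* x)
  arith = solve-∀
  subtree-sum : ∀ b → sum (map (weight (suc H)) (map (b ∷_) (nodes H))) ≡ S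
  subtree-sum b = cong sum (sym (map-∘ (nodes H)))
  children : sum (map (weight (suc H)) (map (false ∷_) (nodes H) ++ map (true ∷_) (nodes H))) ≡ S ℕ.+ S
  children = trans (cong sum (map-++ (weight (suc H)) (map (false ∷_) (nodes H)) _))
    (trans (sum-++ (map (weight (suc H)) (map (false ∷_) (nodes H))) _) (cong₂ ℕ._+_ (subtree-sum false) (subtree-sum true)))

sum-weight-placement : ∀ H (P : Placement H) → sum (tabulate (weight H ∘ Placement.nd P)) ℕ.≤ 2 ℕ.* 4 ^ H
sum-weight-placement H P = ℕ.≤-trans
  (sum-tabulate-injective-≤ (weight H) nd (λ {e} {e′} → Placement.injective P e e′) (nodes H)
    (λ e → ∈-nodes H (nd e) (Placement.inTree P e)))
  (sum-weight-nodes H)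
  where
  nd : Fin (size H) → Path
  nd = Placement.nd P

toℚᵘ-/ : ∀ a m → toℚᵘ (+ a / suc m) ℚᵘ.≃ ℚᵘ.mkℚᵘ (+ a) m
toℚᵘ-/ a m = toℚᵘ-fromℚᵘ (ℚᵘ.mkℚᵘ (+ a) m)

a/m≤b/n : ∀ a b m n .{{_ : NonZero m}} .{{_ : NonZero n}} → a ℕ.* n ℕ.≤ b ℕ.* m → + a / m ≤ + b / n
a/m≤b/n a b (suc m) (suc n) an≤bm = toℚᵘ-cancel-≤ (begin
  toℚᵘ (+ a / suc m)  ≃⟨ toℚᵘ-/ a m ⟩
  ℚᵘ.mkℚᵘ (+ a) m     ≤⟨ ℚᵘ.*≤* (subst₂ ℤ._≤_ (ℤ.pos-* a (suc n)) (ℤ.pos-* b (suc m)) (ℤ.+≤+ an≤bm)) ⟩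
  ℚᵘ.mkℚᵘ (+ b) n     ≃⟨ ℚᵘ.≃-sym (toℚᵘ-/ b n) ⟩
  toℚᵘ (+ b / suc n)  ∎)
  where open ℚᵘ.≤-Reasoning

a/n+b/n≡[a+b]/n : ∀ a b n .{{_ : NonZero n}} → + a / n + + b / n ≡ + (a ℕ.+ b) / n
a/n+b/n≡[a+b]/n a b (suc m) = toℚᵘ-injective (begin
  toℚᵘ (+ a / suc m + + b / suc m)                     ≈⟨ toℚᵘ-homo-+ (+ a / suc m) (+ b / suc m) ⟩
  toℚᵘ (+ a / suc m) ℚᵘ.+ toℚᵘ (+ b / suc m)           ≈⟨ ℚᵘ.+-cong (toℚᵘ-/ a m) (toℚᵘ-/ b m) ⟩
  ℚᵘ.mkℚᵘ (+ a) m ℚᵘ.+ ℚᵘ.mkℚᵘ (+ b) m                 ≈⟨ ℚᵘ.*≡* cross ⟩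
  ℚᵘ.mkℚᵘ (+ (a ℕ.+ b)) m                              ≈⟨ ℚᵘ.≃-sym (toℚᵘ-/ (a ℕ.+ b) m) ⟩
  toℚᵘ (+ (a ℕ.+ b) / suc m)                           ∎)
  where
  open import Relation.Binary.Reasoning.Setoid ℚᵘ.≃-setoid
  open ℤ-Solver
  N : ℤ.ℤ
  N = + suc m
  cross : (+ a ℤ.* N ℤ.+ + b ℤ.* N) ℤ.* N ≡ + (a ℕ.+ b) ℤ.* (N ℤ.* N)
  cross rewrite ℤ.pos-+ a b = solve 3 (λ x y z → (x :* z :+ y :* z) :* z := (x :+ y) :* (z :* z)) refl (+ a) (+ b) N

r/n-r′/n≤1/n : ∀ r r′ n .{{_ : NonZero n}} → r ℕ.≤ suc r′ → + r / n - + r′ / n ≤ + 1 / n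
r/n-r′/n≤1/n r r′ n r≤1+r′ = begin
  + r / n - + r′ / n             ≤⟨ +-monoˡ-≤ (- (+ r′ / n)) r/n≤ ⟩
  (+ r′ / n + + 1 / n) - + r′ / n ≡⟨ solve 2 (λ x y → (x :+ y) :- x := y) refl (+ r′ / n) (+ 1 / n) ⟩
  + 1 / n                        ∎
  where
  open ≤-Reasoning
  open +-*-Solver
  r/n≤ : + r / n ≤ + r′ / n + + 1 / n
  r/n≤ = subst (+ r / n ≤_) (sym (a/n+b/n≡[a+b]/n r′ 1 n))
    (a/m≤b/n r (r′ ℕ.+ 1) n n (ℕ.*-monoˡ-≤ n (subst (r ℕ.≤_) (ℕ.+-comm 1 r′) r≤1+r′)))

4^≡2^2* : ∀ k → 4 ^ k ≡ 2 ^ (2 ℕ.* k)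
4^≡2^2* = ℕ.^-*-assoc 2 2

-- For o ≤ H, share H o = 1/2^(2o+1), written over a denominator common to all o ≤ H.
share : ℕ → ℕ → ℚ
share H o = (+ 4 ^ (H ∸ o) / 2 ^ suc (2 ℕ.* H)) {{ℕ.m^n≢0 2 (suc (2 ℕ.* H))}}

1/2^ℓ≤share : ∀ {H ℓ o} → 2 ℕ.* o ℕ.+ 1 ℕ.≤ ℓ → o ℕ.≤ H → (+ 1 / 2 ^ ℓ) {{ℕ.m^n≢0 2 ℓ}} ≤ share H o
1/2^ℓ≤share {H} {ℓ} {o} 2o+1≤ℓ o≤H =
  a/m≤b/n 1 (4 ^ (H ∸ o)) (2 ^ ℓ) (2 ^ suc (2 ℕ.* H)) {{ℕ.m^n≢0 2 ℓ}} {{ℕ.m^n≢0 2 (suc (2 ℕ.* H))}} (begin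
  1 ℕ.* 2 ^ (1 ℕ.+ 2 ℕ.* H)                      ≡⟨ ℕ.*-identityˡ (2 ^ (1 ℕ.+ 2 ℕ.* H)) ⟩
  2 ^ (1 ℕ.+ 2 ℕ.* H)                            ≡⟨ cong (λ h → 2 ^ (1 ℕ.+ 2 ℕ.* h)) (sym (ℕ.m∸n+n≡m o≤H)) ⟩
  2 ^ (1 ℕ.+ 2 ℕ.* ((H ∸ o) ℕ.+ o))              ≡⟨ cong (2 ^_) (regroup (H ∸ o) o) ⟩
  2 ^ (2 ℕ.* (H ∸ o) ℕ.+ (2 ℕ.* o ℕ.+ 1))        ≡⟨ ℕ.^-distribˡ-+-* 2 (2 ℕ.* (H ∸ o)) _ ⟩
  2 ^ (2 ℕ.* (H ∸ o)) ℕ.* 2 ^ (2 ℕ.* o ℕ.+ 1)    ≤⟨ ℕ.*-monoʳ-≤ (2 ^ (2 ℕ.* (H ∸ o))) (ℕ.^-monoʳ-≤ 2 2o+1≤ℓ) ⟩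
  2 ^ (2 ℕ.* (H ∸ o)) ℕ.* 2 ^ ℓ                  ≡⟨ cong (ℕ._* 2 ^ ℓ) (sym (4^≡2^2* (H ∸ o))) ⟩
  4 ^ (H ∸ o) ℕ.* 2 ^ ℓ                          ∎)
  where
  open ℕ.≤-Reasoning
  regroup : ∀ a b → 1 ℕ.+ 2 ℕ.* (a ℕ.+ b) ≡ 2 ℕ.* a ℕ.+ (2 ℕ.* b ℕ.+ 1)
  regroup = solve-∀

0≤share : ∀ H o → 0ℚ ≤ share H o
0≤share H o = a/m≤b/n 0 (4 ^ (H ∸ o)) 1 (2 ^ suc (2 ℕ.* H)) {{_}} {{ℕ.m^n≢0 2 (suc (2 ℕ.* H))}} z≤n

wFRNK-increase : ∀ {H ℓ o r r′} → r ℕ.≤ suc r′ → o ℕ.≤ H → wFRNK ℓ o r′ - wFRNK ℓ o r ≤ share H o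
wFRNK-increase {H} {ℓ} {o} {r} {r′} r≤1+r′ o≤H with 2 ℕ.* o ℕ.+ 1 ≤ᵇ ℓ in deep
... | false = 0≤share H o
... | true  = begin
  (1ℚ - + r′ / 2 ^ ℓ) - (1ℚ - + r / 2 ^ ℓ) ≡⟨ solve 3 (λ x a b → (x :- a) :- (x :- b) := b :- a) refl 1ℚ (+ r′ / 2 ^ ℓ) (+ r / 2 ^ ℓ) ⟩
  + r / 2 ^ ℓ - + r′ / 2 ^ ℓ              ≤⟨ r/n-r′/n≤1/n r r′ (2 ^ ℓ) r≤1+r′ ⟩
  + 1 / 2 ^ ℓ                             ≤⟨ 1/2^ℓ≤share (ℕ.≤ᵇ⇒≤ _ ℓ (subst T (sym deep) tt)) o≤H ⟩
  share H o                               ∎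
  where
  open ≤-Reasoning
  open +-*-Solver
  instance
    2^ℓ≢0 : NonZero (2 ^ ℓ)
    2^ℓ≢0 = ℕ.m^n≢0 2 ℓ

credit-increase : ∀ {H ρ ρ′ p o} → frnk ρ p ℕ.≤ suc (frnk ρ′ p) → o ℕ.≤ H →
  credit ρ′ p o - credit ρ p o ≤ f * share H o
credit-increase {H} {ρ} {ρ′} {p} {o} frnk≤ o≤H = begin
  credit ρ′ p o - credit ρ p o     ≡⟨ solve 4 (λ c l a b → c :* (l :+ a) :- c :* (l :+ b) := c :* (a :- b))
                                        refl f (wLEV ℓ o) (wFRNK ℓ o (frnk ρ′ p)) (wFRNK ℓ o (frnk ρ p)) ⟩
  f * (wFRNK ℓ o (frnk ρ′ p) - wFRNK ℓ o (frnk ρ p)) ≤⟨ *-monoˡ-≤-nonNeg f (wFRNK-increase frnk≤ o≤H) ⟩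
  f * share H o                    ∎
  where
  open ≤-Reasoning
  open +-*-Solver
  ℓ = level p

sumFin-mono-≤ : ∀ n {g h : Fin n → ℚ} → (∀ i → g i ≤ h i) → sumFin n g ≤ sumFin n h
sumFin-mono-≤ zero    g≤h = ≤-refl
sumFin-mono-≤ (suc n) g≤h = +-mono-≤ (g≤h zero) (sumFin-mono-≤ n (g≤h ∘ suc))

sumFin-*ˡ : ∀ n c (g : Fin n → ℚ) → sumFin n (λ i → c * g i) ≡ c * sumFin n g
sumFin-*ˡ zero    c g = sym (*-zeroʳ c)
sumFin-*ˡ (suc n) c g =
  trans (cong (_+_ (c * g zero)) (sumFin-*ˡ n c (g ∘ suc))) (sym (*-distribˡ-+ c (g zero) _))

sumFin-/ : ∀ n m .{{_ : NonZero m}} (a : Fin n → ℕ) → sumFin n (λ i → + a i / m) ≡ + sum (tabulate a) / m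
sumFin-/ zero    m a = sym (0/n≡0 m)
sumFin-/ (suc n) m a =
  trans (cong (_+_ (+ a zero / m)) (sumFin-/ n m (a ∘ suc))) (a/n+b/n≡[a+b]/n (a zero) _ m)

not-≤ᵇ⇒≰ : ∀ {m n} → not (m ≤ᵇ n) ≡ true → ¬ (m ℕ.≤ n)
not-≤ᵇ⇒≰ {m} {n} m≰ᵇn m≤n with m ≤ᵇ n | ℕ.≤⇒≤ᵇ m≤n
... | true | _ = contradiction m≰ᵇn λ ()

sumFin-share≤1 : ∀ H (P : Placement H) → sumFin (size H) (λ e → share H (level (Placement.nd P e))) ≤ 1ℚ
sumFin-share≤1 H P = begin
  sumFin (size H) (λ e → share H (level (nd e)))   ≡⟨ sumFin-/ (size H) (2 ^ suc (2 ℕ.* H)) (weight H ∘ nd) ⟩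
  + sum (tabulate (weight H ∘ nd)) / 2 ^ suc (2 ℕ.* H) ≤⟨ a/m≤b/n (sum (tabulate (weight H ∘ nd))) 1 (2 ^ suc (2 ℕ.* H)) 1 total≤ ⟩
  1ℚ                                                ∎
  where
  open ≤-Reasoning
  nd : Fin (size H) → Path
  nd = Placement.nd P
  instance
    2^[1+2H]≢0 : NonZero (2 ^ suc (2 ℕ.* H))
    2^[1+2H]≢0 = ℕ.m^n≢0 2 (suc (2 ℕ.* H))
  total≤ : sum (tabulate (weight H ∘ nd)) ℕ.* 1 ℕ.≤ 1 ℕ.* 2 ^ suc (2 ℕ.* H)
  total≤ = subst₂ ℕ._≤_ (sym (ℕ.*-identityʳ _)) (trans (cong (2 ℕ.*_) (4^≡2^2* H)) (sym (ℕ.*-identityˡ _)))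
    (sum-weight-placement H P)

module _ (H : ℕ) (nd : Fin (size H) → Path) (ρ : Rotors) (e* : Fin (size H)) where

  private
    ℓ : Fin (size H) → ℕ
    ℓ e = level (nd e)

    d : ℕ
    d = d* H nd ρ e*

  ndAfter-inB : ∀ e → inB H nd ρ e* e ≡ true → ndAfter H nd ρ e* e ≡ nd e
  ndAfter-inB e e∈B with e ≟F e*
  ... | yes _ = contradiction e∈B λ ()
  ... | no _ with onPath ρ (nd e) | ℓ e <ᵇ d in below | ℓ e ≡ᵇ d in at
  ...   | false | _     | _     = refl
  ...   | true  | false | false = refl
  ...   | true  | true  | _     =
    contradiction (ℕ.<⇒≤ (ℕ.<ᵇ⇒< (ℓ e) d (subst T (sym below) tt))) (not-≤ᵇ⇒≰ {ℓ e} e∈B)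
  ...   | true  | false | true  =
    contradiction (ℕ.≤-reflexive (ℕ.≡ᵇ⇒≡ (ℓ e) d (subst T (sym at) tt))) (not-≤ᵇ⇒≰ {ℓ e} e∈B)

  Δc≤f*share : (ndOpt : Fin (size H) → Path) → (∀ e → level (ndOpt e) ℕ.≤ H) → ∀ e →
    (if inB H nd ρ e* e
     then credit (rotorsAfter H nd ρ e*) (ndAfter H nd ρ e* e) (level (ndOpt e)) - credit ρ (nd e) (level (ndOpt e))
     else 0ℚ) ≤ f * share H (level (ndOpt e))
  Δc≤f*share ndOpt inTree e with inB H nd ρ e* e in e∈B
  ... | false = *-monoˡ-≤-nonNeg f (0≤share H (level (ndOpt e)))
  ... | true rewrite ndAfter-inB e e∈B =
    credit-increase {H} {ρ} {rotorsAfter H nd ρ e*} {nd e} {level (ndOpt e)} (frnk-flip d ρ (nd e)) (inTree e)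

lemma6 : (H : ℕ) (rtr opt : Placement H) (ρ : Rotors) (e* : Fin (size H)) →
         sumΔcB H (Placement.nd rtr) (Placement.nd opt) ρ e* ≤ f
lemma6 H rtr opt ρ e* = begin
  sumΔcB H (nd rtr) (nd opt) ρ e*                         ≤⟨ sumFin-mono-≤ (size H) (Δc≤f*share H (nd rtr) ρ e* (nd opt) (inTree opt)) ⟩
  sumFin (size H) (λ e → f * share H (level (nd opt e)))  ≡⟨ sumFin-*ˡ (size H) f _ ⟩
  f * sumFin (size H) (λ e → share H (level (nd opt e)))  ≤⟨ *-monoˡ-≤-nonNeg f (sumFin-share≤1 H opt) ⟩
  f * 1ℚ                                                  ≡⟨ *-identityʳ f ⟩
  f                                                       ∎
  where
  open ≤-Reasoning
  open Placement
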